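{- For all integers $n \geq 2$ and $k \geq 1$, the number of $k$-chains of $(\mathsf{Tr}(n),\preccurlyeq)$ equals $(k+1)^{n-(k+1)} P_k(n)$, where $P_k$ is a monic polynomial of degree $k$ (with rational coefficients) depending only on $k$.
   Context: For $n\ge1$, $\mathsf{Tr}(n)$ is the set of words $u = u_1\cdots u_n$ over $\{0,1,2\}$ with $u_1 \neq 2$ and no indices $i<j$ with $u_i=0$, $u_j=1$, ordered componentwise ($u\preccurlyeq v$ iff $u_i\le v_i$ for all $i$). A $k$-chain is a sequence $(u^{(1)},\dots,u^{(k)})$ of $k$ elements with $u^{(1)} \preccurlyeq u^{(2)} \preccurlyeq \cdots \preccurlyeq u^{(k)}$ (repetitions allowed). -}

module Defs where

open import Data.Nat as ℕ using (ℕ; zero; suc)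
open import Data.Integer as ℤ using (ℤ; +_; -[1+_])
open import Data.Rational as ℚ using (ℚ; _/_; 0ℚ; 1ℚ)
open import Data.Fin using (Fin; zero; suc)
open import Data.Bool using (Bool; true; false; _∧_; _∨_; not)
open import Data.Vec as Vec using (Vec; []; _∷_)
open import Data.List as List using (List; []; _∷_; filter; length; concatMap; map; allFin)
open import Relation.Binary.PropositionalEquality using (_≡_)
open import Data.Bool.Properties using (T?)

-- Letters 0,1,2 are represented by Fin 3 (zero, suc zero, suc (suc zero)).
Letter : Set
Letter = Fin 3

Word : ℕ → Set
Word n = Vec Letter n

is0 is1 is2 : Letter → Bool
is0 zero = true
is0 _    = false
is1 (suc zero) = true
is1 _          = false
is2 (suc (suc zero)) = true
is2 _                = false

leqL : Letter → Letter → Bool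
leqL zero _ = true
leqL (suc zero) zero = false
leqL (suc zero) _ = true
leqL (suc (suc zero)) (suc (suc zero)) = true
leqL (suc (suc zero)) _ = false

no1 : ∀ {n} → Word n → Bool
no1 [] = true
no1 (a ∷ u) = not (is1 a) ∧ no1 u

no01 : ∀ {n} → Word n → Bool
no01 [] = true
no01 (a ∷ u) = (not (is0 a) ∨ no1 u) ∧ no01 u

-- membership in Tr(n): u_1 ≠ 2 and no 0 before a 1 (only used for n ≥ 1)
isTr : ∀ {n} → Word n → Bool
isTr [] = false
isTr (a ∷ u) = not (is2 a) ∧ no01 (a ∷ u)

leqW : ∀ {n} → Word n → Word n → Bool
leqW [] [] = true
leqW (a ∷ u) (b ∷ v) = leqL a b ∧ leqW u v

allWords : (n : ℕ) → List (Word n)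
allWords zero = [] ∷ []
allWords (suc n) = concatMap (λ a → map (a ∷_) (allWords n)) (allFin 3)

Tr : (n : ℕ) → List (Word n)
Tr n = filter (λ u → T? (isTr u)) (allWords n)

tuples : ∀ {A : Set} (k : ℕ) → List A → List (Vec A k)
tuples zero xs = [] ∷ []
tuples (suc k) xs = concatMap (λ x → map (x ∷_) (tuples k xs)) xs

isChain : ∀ {n k} → Vec (Word n) k → Bool
isChain [] = true
isChain (u ∷ []) = true
isChain (u ∷ v ∷ us) = leqW u v ∧ isChain (v ∷ us)

numChains : (n k : ℕ) → ℕ
numChains n k = length (filter (λ c → T? (isChain c)) (tuples k (Tr n)))

fromℕ : ℕ → ℚ
fromℕ m = + m / 1

powℚ : ℚ → ℕ → ℚ
powℚ x zero = 1ℚ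
powℚ x (suc m) = x ℚ.* powℚ x m

powSuc : ℕ → ℤ → ℚ
powSuc b (+ m) = powℚ (fromℕ (suc b)) m
powSuc b -[1+ m ] = powℚ (+ 1 / suc b) (suc m)

-- the monic polynomial of degree k with lower coefficients c₀,…,c_{k-1}:
-- P(x) = x^k + Σ_{i<k} cᵢ xⁱ
lowerPart : ∀ {m} → Vec ℚ m → ℚ → ℚ
lowerPart [] x = 0ℚ
lowerPart (c ∷ cs) x = c ℚ.+ x ℚ.* lowerPart cs x

monicEval : ∀ {k} → Vec ℚ k → ℚ → ℚ
monicEval {k} cs x = powℚ x k ℚ.+ lowerPart cs x

-- Transposing a k-chain of words of length n gives n columns in {0,1,2}ᵏ, each
-- ascending, i.e. of the form 0ᵃ1ᶜ2^(k-a-c).  Reading the columns left to right, the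
-- row conditions (no 0 before a 1, no leading 2) only need to remember which rows have
-- already seen a 0, and for ascending columns this is always an initial segment of rows.
-- With d the number of rows still free of 0, the counts h(n,d) satisfy
--   h(n+1,d) = (k+1) h(n,d) + Σ_{j<d} (j+1) h(n,j),
-- whose solution is h(n,d) = Σ_r C(n,r) (k+1)^(n-r) Λ_r(d) with Λ_r(d) = 0 for d < r
-- and Λ_r(r) = r!.  Hence the number of chains in Tr(m+1) is
-- Σ_{r≤k} C(m,r) (k+1)^(m-r) Γ_r with Γ_r = Σ_{d≤k} Λ_r(d), that is
-- (k+1)^(m-k) times a polynomial in m+1 of degree k with leading coefficient Γ_k/k! = 1.

module Submission where

open import Defs
open import Data.Nat using (ℕ; suc; _≤_)
open import Data.Integer using (_-_; +_)
open import Data.Rational using (ℚ)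
open import Data.Vec using (Vec)
open import Data.Product using (Σ)
open import Relation.Binary.PropositionalEquality using (_≡_)

open import Algebra.Bundles using (CommutativeMonoid)
import Algebra.Properties.CommutativeSemigroup as CommSemigroupProperties
open import Data.Bool using (Bool; true; false; _∧_; _∨_; not)
open import Data.Bool.Properties using (T?; ∧-idem; ∧-commutativeMonoid)
open import Data.Fin using (zero; suc)
open import Data.Integer as ℤ using (_⊖_)
import Data.Integer.Properties as ℤ
open import Data.List using (List; []; _∷_; _++_; map; concatMap; filter; length; allFin)
open import Data.Nat using (zero; _+_; _*_; _∸_; _^_; _<_; _⊔_; z≤n; s≤s; _!)
open import Data.Nat.Combinatorics using (_C_; k>n⇒nCk≡0; nCk+nC[k+1]≡[n+1]C[k+1]; nC1≡n)
import Data.Nat.Coprimality as Coprime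
import Data.Nat.Properties as ℕ
open import Data.Nat.Solver using (module +-*-Solver)
open import Data.Product using (_,_)
open import Data.Rational as ℚ using (0ℚ; 1ℚ; mkℚ; _/_)
import Data.Rational.Properties as ℚ
import Data.Rational.Solver as ℚ-Solver
open import Data.Vec as Vec using ([]; _∷_; replicate)
open import Relation.Nullary using (yes; no)
open import Relation.Binary.PropositionalEquality using (refl; sym; trans; cong; cong₂; module ≡-Reasoning)

open CommSemigroupProperties ℕ.+-commutativeSemigroup using () renaming (interchange to +-interchange)
open CommSemigroupProperties (CommutativeMonoid.commutativeSemigroup ∧-commutativeMonoid)
  using () renaming (interchange to ∧-interchange)
open +-*-Solver using (solve; _:+_; _:*_; _:=_; con)
open ℚ-Solver.+-*-Solver using ()
  renaming (solve to solveℚ; _:+_ to _⊕_; _:*_ to _⊗_; _:=_ to _≐_; con to conℚ; :-_ to ⊝_)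

private
  variable
    A B : Set

-- Finite sums

𝟙 : Bool → ℕ
𝟙 true  = 1
𝟙 false = 0

𝟙-∧ : ∀ a b → 𝟙 (a ∧ b) ≡ 𝟙 a * 𝟙 b
𝟙-∧ true  b = sym (ℕ.+-identityʳ (𝟙 b))
𝟙-∧ false b = refl

∑ : List A → (A → ℕ) → ℕ
∑ []       f = 0
∑ (x ∷ xs) f = f x + ∑ xs f

syntax ∑ xs (λ x → e) = ∑[ x ∈ xs ] e

∑-cong : ∀ (xs : List A) {f g : A → ℕ} → (∀ x → f x ≡ g x) → ∑ xs f ≡ ∑ xs g
∑-cong []       f≗g = refl
∑-cong (x ∷ xs) f≗g = cong₂ _+_ (f≗g x) (∑-cong xs f≗g)

∑-++ : ∀ (xs ys : List A) f → ∑ (xs ++ ys) f ≡ ∑ xs f + ∑ ys f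
∑-++ []       ys f = refl
∑-++ (x ∷ xs) ys f = trans (cong (_+_ (f x)) (∑-++ xs ys f)) (sym (ℕ.+-assoc (f x) _ _))

∑-0 : ∀ (xs : List A) → ∑[ x ∈ xs ] 0 ≡ 0
∑-0 []       = refl
∑-0 (x ∷ xs) = ∑-0 xs

∑-+ : ∀ (xs : List A) f g → ∑[ x ∈ xs ] (f x + g x) ≡ ∑ xs f + ∑ xs g
∑-+ []       f g = refl
∑-+ (x ∷ xs) f g = trans (cong (_+_ (f x + g x)) (∑-+ xs f g)) (+-interchange (f x) (g x) _ _)

∑-*ˡ : ∀ (xs : List A) c f → ∑[ x ∈ xs ] (c * f x) ≡ c * ∑ xs f
∑-*ˡ []       c f = sym (ℕ.*-zeroʳ c)
∑-*ˡ (x ∷ xs) c f = trans (cong (_+_ (c * f x)) (∑-*ˡ xs c f)) (sym (ℕ.*-distribˡ-+ c (f x) _))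

∑-comm : ∀ (xs : List A) (ys : List B) (f : A → B → ℕ) →
  ∑[ x ∈ xs ] ∑ ys (f x) ≡ ∑[ y ∈ ys ] ∑[ x ∈ xs ] f x y
∑-comm []       ys f = sym (∑-0 ys)
∑-comm (x ∷ xs) ys f =
  trans (cong (_+_ (∑ ys (f x))) (∑-comm xs ys f)) (sym (∑-+ ys (f x) (λ y → ∑[ x ∈ xs ] f x y)))

∑-concatMap : ∀ (g : A → List B) xs f → ∑ (concatMap g xs) f ≡ ∑[ x ∈ xs ] ∑ (g x) f
∑-concatMap g []       f = refl
∑-concatMap g (x ∷ xs) f = trans (∑-++ (g x) _ f) (cong (_+_ (∑ (g x) f)) (∑-concatMap g xs f))

∑-map : ∀ (g : A → B) xs f → ∑ (map g xs) f ≡ ∑[ x ∈ xs ] f (g x)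
∑-map g []       f = refl
∑-map g (x ∷ xs) f = cong (_+_ (f (g x))) (∑-map g xs f)

∑-filter : ∀ (p : A → Bool) xs f → ∑ (filter (λ x → T? (p x)) xs) f ≡ ∑[ x ∈ xs ] (𝟙 (p x) * f x)
∑-filter p []       f = refl
∑-filter p (x ∷ xs) f with p x
... | true  = cong₂ _+_ (sym (ℕ.+-identityʳ (f x))) (∑-filter p xs f)
... | false = ∑-filter p xs f

length-filter : ∀ (p : A → Bool) xs → length (filter (λ x → T? (p x)) xs) ≡ ∑[ x ∈ xs ] 𝟙 (p x)
length-filter p []       = refl
length-filter p (x ∷ xs) with p x
... | true  = cong suc (length-filter p xs)
... | false = length-filter p xs

all : ∀ {k} → (A → Bool) → Vec A k → Bool
all p []       = true
all p (x ∷ xs) = p x ∧ all p xs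

∑-tuples-suc : ∀ k (xs : List A) f → ∑ (tuples (suc k) xs) f ≡ ∑[ x ∈ xs ] ∑[ c ∈ tuples k xs ] f (x ∷ c)
∑-tuples-suc k xs f = trans (∑-concatMap (λ x → map (x ∷_) (tuples k xs)) xs f)
                            (∑-cong xs (λ x → ∑-map (x ∷_) (tuples k xs) f))

∑-tuples-filter : ∀ (p : A → Bool) k xs f →
  ∑ (tuples k (filter (λ x → T? (p x)) xs)) f ≡ ∑[ c ∈ tuples k xs ] (𝟙 (all p c) * f c)
∑-tuples-filter p zero    xs f = cong (_+ 0) (sym (ℕ.+-identityʳ (f [])))
∑-tuples-filter p (suc k) xs f = begin
  ∑ (tuples (suc k) ys) f
    ≡⟨ ∑-tuples-suc k ys f ⟩
  ∑[ x ∈ ys ] ∑[ c ∈ tuples k ys ] f (x ∷ c)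
    ≡⟨ ∑-cong ys (λ x → ∑-tuples-filter p k xs (λ c → f (x ∷ c))) ⟩
  ∑[ x ∈ ys ] ∑[ c ∈ tuples k xs ] (𝟙 (all p c) * f (x ∷ c))
    ≡⟨ ∑-filter p xs _ ⟩
  ∑[ x ∈ xs ] (𝟙 (p x) * ∑[ c ∈ tuples k xs ] (𝟙 (all p c) * f (x ∷ c)))
    ≡⟨ ∑-cong xs (λ x → sym (∑-*ˡ (tuples k xs) (𝟙 (p x)) _)) ⟩
  ∑[ x ∈ xs ] ∑[ c ∈ tuples k xs ] (𝟙 (p x) * (𝟙 (all p c) * f (x ∷ c)))
    ≡⟨ ∑-cong xs (λ x → ∑-cong (tuples k xs) (λ c →
         trans (sym (ℕ.*-assoc (𝟙 (p x)) _ _)) (cong (_* f (x ∷ c)) (sym (𝟙-∧ (p x) (all p c)))))) ⟩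
  ∑[ x ∈ xs ] ∑[ c ∈ tuples k xs ] (𝟙 (all p (x ∷ c)) * f (x ∷ c))
    ≡⟨ ∑-tuples-suc k xs _ ⟨
  ∑[ c ∈ tuples (suc k) xs ] (𝟙 (all p c) * f c) ∎
  where
  open ≡-Reasoning
  ys = filter (λ x → T? (p x)) xs

∑-tuples-singleton : ∀ k (x : A) f → ∑ (tuples k (x ∷ [])) f ≡ f (replicate k x)
∑-tuples-singleton zero    x f = ℕ.+-identityʳ _
∑-tuples-singleton (suc k) x f =
  trans (∑-tuples-suc k (x ∷ []) f) (trans (ℕ.+-identityʳ _) (∑-tuples-singleton k x (λ c → f (x ∷ c))))

∑< : ℕ → (ℕ → ℕ) → ℕ
∑< zero    f = 0
∑< (suc n) f = f 0 + ∑< n (λ i → f (suc i))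

syntax ∑< n (λ i → e) = ∑[ i < n ] e

∑<-cong : ∀ n {f g : ℕ → ℕ} → (∀ i → i < n → f i ≡ g i) → ∑< n f ≡ ∑< n g
∑<-cong zero    f≗g = refl
∑<-cong (suc n) f≗g = cong₂ _+_ (f≗g 0 (s≤s z≤n)) (∑<-cong n (λ i i<n → f≗g (suc i) (s≤s i<n)))

∑<-const : ∀ n c → ∑[ i < n ] c ≡ n * c
∑<-const zero    c = refl
∑<-const (suc n) c = cong (_+_ c) (∑<-const n c)

∑<-vanishing : ∀ n {f : ℕ → ℕ} → (∀ i → i < n → f i ≡ 0) → ∑< n f ≡ 0
∑<-vanishing n f≗0 = trans (∑<-cong n f≗0) (trans (∑<-const n 0) (ℕ.*-zeroʳ n))

∑<-+ : ∀ n f g → ∑[ i < n ] (f i + g i) ≡ ∑< n f + ∑< n g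
∑<-+ zero    f g = refl
∑<-+ (suc n) f g = trans (cong (_+_ (f 0 + g 0)) (∑<-+ n (λ i → f (suc i)) (λ i → g (suc i))))
                         (+-interchange (f 0) (g 0) _ _)

∑<-*ˡ : ∀ n c f → ∑[ i < n ] (c * f i) ≡ c * ∑< n f
∑<-*ˡ zero    c f = sym (ℕ.*-zeroʳ c)
∑<-*ˡ (suc n) c f = trans (cong (_+_ (c * f 0)) (∑<-*ˡ n c (λ i → f (suc i)))) (sym (ℕ.*-distribˡ-+ c (f 0) _))

∑<-*ʳ : ∀ n c f → ∑[ i < n ] (f i * c) ≡ ∑< n f * c
∑<-*ʳ n c f = trans (∑<-cong n (λ i _ → ℕ.*-comm (f i) c)) (trans (∑<-*ˡ n c f) (ℕ.*-comm c _))

∑<-comm : ∀ n m (f : ℕ → ℕ → ℕ) → ∑[ i < n ] ∑[ j < m ] f i j ≡ ∑[ j < m ] ∑[ i < n ] f i j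
∑<-comm zero    m f = sym (∑<-vanishing m (λ _ _ → refl))
∑<-comm (suc n) m f = trans (cong (_+_ (∑< m (f 0))) (∑<-comm n m (λ i → f (suc i))))
                            (sym (∑<-+ m (f 0) (λ j → ∑[ i < n ] f (suc i) j)))

∑<-split : ∀ a b f → ∑< (a + b) f ≡ ∑< a f + ∑[ i < b ] f (a + i)
∑<-split zero    b f = refl
∑<-split (suc a) b f = trans (cong (_+_ (f 0)) (∑<-split a b (λ i → f (suc i)))) (sym (ℕ.+-assoc (f 0) _ _))

∑<-extend : ∀ n j {f : ℕ → ℕ} → (∀ i → n ≤ i → f i ≡ 0) → ∑< (n + j) f ≡ ∑< n f
∑<-extend n j {f} f≗0 = begin
  ∑< (n + j) f                        ≡⟨ ∑<-split n j f ⟩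
  ∑< n f + ∑[ i < j ] f (n + i)       ≡⟨ cong (_+_ (∑< n f)) (∑<-vanishing j (λ i _ → f≗0 (n + i) (ℕ.m≤m+n n i))) ⟩
  ∑< n f + 0                          ≡⟨ ℕ.+-identityʳ _ ⟩
  ∑< n f                              ∎
  where open ≡-Reasoning

∑<-snoc : ∀ n f → ∑< (suc n) f ≡ ∑< n f + f n
∑<-snoc n f = trans (cong (λ m → ∑< m f) (ℕ.+-comm 1 n))
                    (trans (∑<-split n 1 f) (cong (_+_ (∑< n f)) (trans (ℕ.+-identityʳ _) (cong f (ℕ.+-identityʳ n)))))

∑<-reverse : ∀ n f → ∑< n f ≡ ∑[ i < n ] f (n ∸ suc i)
∑<-reverse zero    f = refl
∑<-reverse (suc n) f = trans (∑<-snoc n f) (trans (cong (_+ f n) (∑<-reverse n f)) (ℕ.+-comm _ (f n)))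

-- Reading chains column by column

letters : List Letter
letters = allFin 3

infixr 5 _∷ᶜ_

_∷ᶜ_ : ∀ {n k} → Vec Letter k → Vec (Word n) k → Vec (Word (suc n)) k
_∷ᶜ_ = Vec.zipWith _∷_

∑-allWords-suc : ∀ n f → ∑ (allWords (suc n)) f ≡ ∑[ a ∈ letters ] ∑[ u ∈ allWords n ] f (a ∷ u)
∑-allWords-suc n f = trans (∑-concatMap (λ a → map (a ∷_) (allWords n)) letters f)
                           (∑-cong letters (λ a → ∑-map (a ∷_) (allWords n) f))

∑-tuples-transpose : ∀ n k (F : Vec (Word (suc n)) k → ℕ) →
  ∑ (tuples k (allWords (suc n))) F
    ≡ ∑[ col ∈ tuples k letters ] ∑[ us ∈ tuples k (allWords n) ] F (col ∷ᶜ us)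
∑-tuples-transpose n zero    F = cong (_+ 0) (sym (ℕ.+-identityʳ (F [])))
∑-tuples-transpose n (suc k) F = begin
  ∑ (tuples (suc k) W′) F
    ≡⟨ ∑-tuples-suc k W′ F ⟩
  ∑[ w ∈ W′ ] ∑[ ws ∈ tuples k W′ ] F (w ∷ ws)
    ≡⟨ ∑-allWords-suc n _ ⟩
  ∑[ a ∈ letters ] ∑[ u ∈ W ] ∑[ ws ∈ tuples k W′ ] F ((a ∷ u) ∷ ws)
    ≡⟨ ∑-cong letters (λ a → ∑-cong W (λ u → ∑-tuples-transpose n k (λ ws → F ((a ∷ u) ∷ ws)))) ⟩
  ∑[ a ∈ letters ] ∑[ u ∈ W ] ∑[ col ∈ tuples k letters ] ∑[ us ∈ tuples k W ] F ((a ∷ u) ∷ (col ∷ᶜ us))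
    ≡⟨ ∑-cong letters (λ a → ∑-comm W (tuples k letters) (λ u col → ∑[ us ∈ tuples k W ] F ((a ∷ u) ∷ (col ∷ᶜ us)))) ⟩
  ∑[ a ∈ letters ] ∑[ col ∈ tuples k letters ] ∑[ u ∈ W ] ∑[ us ∈ tuples k W ] F ((a ∷ u) ∷ (col ∷ᶜ us))
    ≡⟨ ∑-cong letters (λ a → ∑-cong (tuples k letters) (λ col → ∑-tuples-suc k W (λ us → F ((a ∷ col) ∷ᶜ us)))) ⟨
  ∑[ a ∈ letters ] ∑[ col ∈ tuples k letters ] ∑[ us ∈ tuples (suc k) W ] F ((a ∷ col) ∷ᶜ us)
    ≡⟨ ∑-tuples-suc k letters _ ⟨
  ∑[ col ∈ tuples (suc k) letters ] ∑[ us ∈ tuples (suc k) W ] F (col ∷ᶜ us) ∎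
  where
  open ≡-Reasoning
  W  = allWords n
  W′ = allWords (suc n)

allowed : Bool → Letter → Bool
allowed seen0 c = not seen0 ∨ not (is1 c)

-- validAfter s u: the letters u may follow a prefix of the row that contains a 0 iff s.
validAfter : ∀ {n} → Bool → Word n → Bool
validAfter seen0 []      = true
validAfter seen0 (c ∷ u) = allowed seen0 c ∧ validAfter (seen0 ∨ is0 c) u

validAfter-true : ∀ {n} (u : Word n) → validAfter true u ≡ no1 u
validAfter-true []      = refl
validAfter-true (c ∷ u) = cong (not (is1 c) ∧_) (validAfter-true u)

no1∧no01 : ∀ {n} (u : Word n) → no1 u ∧ no01 u ≡ no1 u
no1∧no01 []                   = refl
no1∧no01 (zero ∷ u)           = trans (cong (no1 u ∧_) (no1∧no01 u)) (∧-idem (no1 u))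
no1∧no01 (suc zero ∷ u)       = refl
no1∧no01 (suc (suc zero) ∷ u) = no1∧no01 u

validAfter-false : ∀ {n} (u : Word n) → validAfter false u ≡ no01 u
validAfter-false []                   = refl
validAfter-false (zero ∷ u)           = trans (validAfter-true u) (sym (no1∧no01 u))
validAfter-false (suc zero ∷ u)       = validAfter-false u
validAfter-false (suc (suc zero) ∷ u) = validAfter-false u

allValid : ∀ {n k} → Vec Bool k → Vec (Word n) k → Bool
allValid []       []       = true
allValid (s ∷ ss) (u ∷ us) = validAfter s u ∧ allValid ss us

admissible : ∀ {k} → Vec Bool k → Vec Letter k → Bool
admissible []       []       = true
admissible (s ∷ ss) (c ∷ cs) = allowed s c ∧ admissible ss cs

allValid-∷ᶜ : ∀ {n k} (ss : Vec Bool k) col (us : Vec (Word n) k) →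
  allValid ss (col ∷ᶜ us)
    ≡ admissible ss col ∧ allValid (Vec.zipWith _∨_ ss (Vec.map is0 col)) us
allValid-∷ᶜ []       []       []       = refl
allValid-∷ᶜ (s ∷ ss) (c ∷ cs) (u ∷ us) =
  trans (cong ((allowed s c ∧ validAfter (s ∨ is0 c) u) ∧_) (allValid-∷ᶜ ss cs us))
        (∧-interchange (allowed s c) _ (admissible ss cs) _)

no2 : ∀ {k} → Vec Letter k → Bool
no2 = all (λ c → not (is2 c))

all-isTr-∷ᶜ : ∀ {n k} col (us : Vec (Word n) k) →
  all isTr (col ∷ᶜ us) ≡ no2 col ∧ allValid (Vec.map is0 col) us
all-isTr-∷ᶜ []       []       = refl
all-isTr-∷ᶜ (c ∷ cs) (u ∷ us) =
  trans (cong₂ (λ x y → (not (is2 c) ∧ x) ∧ y) (sym (validAfter-false (c ∷ u))) (all-isTr-∷ᶜ cs us))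
        (∧-interchange (not (is2 c)) _ (no2 cs) _)

ascendingFrom : ∀ {k} → Letter → Vec Letter k → Bool
ascendingFrom x []       = true
ascendingFrom x (y ∷ ys) = leqL x y ∧ ascendingFrom y ys

ascending : ∀ {k} → Vec Letter k → Bool
ascending = ascendingFrom zero

isChain-∷ᶜ : ∀ {n k} col (us : Vec (Word n) k) →
  isChain (col ∷ᶜ us) ≡ ascending col ∧ isChain us
isChain-∷ᶜ []           []           = refl
isChain-∷ᶜ (a ∷ [])     (u ∷ [])     = refl
isChain-∷ᶜ (a ∷ b ∷ cs) (u ∷ v ∷ us) =
  trans (cong ((leqL a b ∧ leqW u v) ∧_) (isChain-∷ᶜ (b ∷ cs) (v ∷ us)))
        (∧-interchange (leqL a b) (leqW u v) (ascendingFrom b cs) (isChain (v ∷ us)))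

-- k-chains of length-n words whose i-th row may follow a prefix containing a 0 iff ss i.
chainsAfter : ∀ {k} → ℕ → Vec Bool k → ℕ
chainsAfter {k} n ss = ∑[ us ∈ tuples k (allWords n) ] 𝟙 (isChain us ∧ allValid ss us)

∑-chains-byFirstColumn : ∀ n k (R : Vec (Word (suc n)) k → Bool)
  (q : Vec Letter k → Bool) (g : Vec Letter k → Vec Bool k) →
  (∀ col us → R (col ∷ᶜ us) ≡ q col ∧ allValid (g col) us) →
  ∑[ us ∈ tuples k (allWords (suc n)) ] 𝟙 (isChain us ∧ R us)
    ≡ ∑[ col ∈ tuples k letters ] (𝟙 (ascending col) * (𝟙 (q col) * chainsAfter n (g col)))
∑-chains-byFirstColumn n k R q g R-∷ᶜ =
  trans (∑-tuples-transpose n k _) (∑-cong (tuples k letters) perColumn)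
  where
  open ≡-Reasoning
  perColumn : ∀ col → ∑[ us ∈ tuples k (allWords n) ] 𝟙 (isChain (col ∷ᶜ us) ∧ R (col ∷ᶜ us))
                        ≡ 𝟙 (ascending col) * (𝟙 (q col) * chainsAfter n (g col))
  perColumn col = begin
    ∑[ us ∈ tuples k (allWords n) ] 𝟙 (isChain (col ∷ᶜ us) ∧ R (col ∷ᶜ us))
      ≡⟨ ∑-cong (tuples k (allWords n)) (λ us → cong 𝟙 (trans
           (cong₂ _∧_ (isChain-∷ᶜ col us) (R-∷ᶜ col us))
           (∧-interchange (ascending col) (isChain us) (q col) (allValid (g col) us)))) ⟩
    ∑[ us ∈ tuples k (allWords n) ] 𝟙 ((ascending col ∧ q col) ∧ (isChain us ∧ allValid (g col) us))
      ≡⟨ ∑-cong (tuples k (allWords n)) (λ us → 𝟙-∧ (ascending col ∧ q col) _) ⟩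
    ∑[ us ∈ tuples k (allWords n) ] (𝟙 (ascending col ∧ q col) * 𝟙 (isChain us ∧ allValid (g col) us))
      ≡⟨ ∑-*ˡ (tuples k (allWords n)) (𝟙 (ascending col ∧ q col)) _ ⟩
    𝟙 (ascending col ∧ q col) * chainsAfter n (g col)
      ≡⟨ trans (cong (_* chainsAfter n (g col)) (𝟙-∧ (ascending col) (q col))) (ℕ.*-assoc (𝟙 (ascending col)) _ _) ⟩
    𝟙 (ascending col) * (𝟙 (q col) * chainsAfter n (g col)) ∎

chainsAfter-suc : ∀ {k} n (ss : Vec Bool k) →
  chainsAfter (suc n) ss
    ≡ ∑[ col ∈ tuples k letters ]
        (𝟙 (ascending col) * (𝟙 (admissible ss col) * chainsAfter n (Vec.zipWith _∨_ ss (Vec.map is0 col))))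
chainsAfter-suc {k} n ss = ∑-chains-byFirstColumn n k (allValid ss) (admissible ss)
  (λ col → Vec.zipWith _∨_ ss (Vec.map is0 col)) (allValid-∷ᶜ ss)

numChains-suc : ∀ n k →
  numChains (suc n) k
    ≡ ∑[ col ∈ tuples k letters ]
        (𝟙 (ascending col) * (𝟙 (no2 col) * chainsAfter n (Vec.map is0 col)))
numChains-suc n k = begin
  numChains (suc n) k
    ≡⟨ length-filter isChain (tuples k (Tr (suc n))) ⟩
  ∑[ us ∈ tuples k (Tr (suc n)) ] 𝟙 (isChain us)
    ≡⟨ ∑-tuples-filter isTr k (allWords (suc n)) (λ us → 𝟙 (isChain us)) ⟩
  ∑[ us ∈ tuples k (allWords (suc n)) ] (𝟙 (all isTr us) * 𝟙 (isChain us))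
    ≡⟨ ∑-cong (tuples k (allWords (suc n))) (λ us → trans (ℕ.*-comm (𝟙 (all isTr us)) _) (sym (𝟙-∧ (isChain us) _))) ⟩
  ∑[ us ∈ tuples k (allWords (suc n)) ] 𝟙 (isChain us ∧ all isTr us)
    ≡⟨ ∑-chains-byFirstColumn n k (all isTr) no2 (Vec.map is0) all-isTr-∷ᶜ ⟩
  ∑[ col ∈ tuples k letters ]
    (𝟙 (ascending col) * (𝟙 (no2 col) * chainsAfter n (Vec.map is0 col))) ∎
  where open ≡-Reasoning

-- Ascending columns and the recurrence

-- Every ascending column is column a c (a zeros, c ones, then twos) for a unique a + c ≤ k.
column : ∀ {k} → ℕ → ℕ → Vec Letter k
column {zero}  a       c       = []
column {suc k} (suc a) c       = zero ∷ column a c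
column {suc k} zero    (suc c) = suc zero ∷ column zero c
column {suc k} zero    zero    = suc (suc zero) ∷ column zero zero

∑-ascendingFrom-2 : ∀ k (ψ : Vec Letter k → ℕ) →
  ∑[ col ∈ tuples k letters ] (𝟙 (ascendingFrom (suc (suc zero)) col) * ψ col) ≡ ψ (column 0 0)
∑-ascendingFrom-2 zero    ψ = trans (ℕ.+-identityʳ _) (ℕ.+-identityʳ _)
∑-ascendingFrom-2 (suc k) ψ =
  trans (∑-tuples-suc k letters _)
        (trans (cong₂ _+_ (∑-0 (tuples k letters)) (cong₂ _+_ (∑-0 (tuples k letters)) (ℕ.+-identityʳ _)))
               (∑-ascendingFrom-2 k (λ c → ψ (suc (suc zero) ∷ c))))

∑-ascendingFrom-1 : ∀ k (ψ : Vec Letter k → ℕ) →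
  ∑[ col ∈ tuples k letters ] (𝟙 (ascendingFrom (suc zero) col) * ψ col) ≡ ∑[ c < suc k ] ψ (column 0 c)
∑-ascendingFrom-1 zero    ψ = cong (_+ 0) (ℕ.+-identityʳ _)
∑-ascendingFrom-1 (suc k) ψ =
  trans (∑-tuples-suc k letters _)
        (trans (cong₂ _+_ (∑-0 (tuples k letters))
                          (cong₂ _+_ (∑-ascendingFrom-1 k (λ c → ψ (suc zero ∷ c)))
                                     (trans (ℕ.+-identityʳ _) (∑-ascendingFrom-2 k (λ c → ψ (suc (suc zero) ∷ c))))))
               (ℕ.+-comm (∑[ c < suc k ] ψ (column 0 (suc c))) _))

∑-ascending : ∀ k (ψ : Vec Letter k → ℕ) →
  ∑[ col ∈ tuples k letters ] (𝟙 (ascending col) * ψ col) ≡ ∑[ a < suc k ] ∑[ c < suc k ∸ a ] ψ (column a c)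
∑-ascending zero    ψ = refl
∑-ascending (suc k) ψ =
  trans (∑-tuples-suc k letters _)
        (trans (cong₂ _+_ (∑-ascending k (λ c → ψ (zero ∷ c)))
                          (cong₂ _+_ (∑-ascendingFrom-1 k (λ c → ψ (suc zero ∷ c)))
                                     (trans (ℕ.+-identityʳ _) (∑-ascendingFrom-2 k (λ c → ψ (suc (suc zero) ∷ c))))))
               (solve 3 (λ x y z → x :+ (y :+ z) := (z :+ y) :+ x) refl
                  (∑[ a < suc k ] ∑[ c < suc k ∸ a ] ψ (zero ∷ column a c))
                  (∑[ c < suc k ] ψ (suc zero ∷ column 0 c))
                  (ψ (suc (suc zero) ∷ column 0 0))))

-- After any sequence of ascending columns, the rows that have seen a 0 are the first t rows.
prefix : ∀ {k} → ℕ → Vec Bool k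
prefix {zero}  t       = []
prefix {suc k} zero    = false ∷ prefix zero
prefix {suc k} (suc t) = true ∷ prefix t

map-is0-column : ∀ {k} a c → Vec.map is0 (column {k} a c) ≡ prefix a
map-is0-column {zero}  a       c       = refl
map-is0-column {suc k} (suc a) c       = cong (true ∷_) (map-is0-column a c)
map-is0-column {suc k} zero    (suc c) = cong (false ∷_) (map-is0-column zero c)
map-is0-column {suc k} zero    zero    = cong (false ∷_) (map-is0-column zero zero)

zipWith-∨-prefix : ∀ {k} t a → Vec.zipWith _∨_ (prefix {k} t) (prefix a) ≡ prefix (t ⊔ a)
zipWith-∨-prefix {zero}  t       a       = refl
zipWith-∨-prefix {suc k} zero    zero    = cong (false ∷_) (zipWith-∨-prefix zero zero)
zipWith-∨-prefix {suc k} zero    (suc a) = cong (true ∷_) (zipWith-∨-prefix zero a)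
zipWith-∨-prefix {suc k} (suc t) zero    = cong (true ∷_) (trans (zipWith-∨-prefix t zero) (cong prefix (ℕ.⊔-identityʳ t)))
zipWith-∨-prefix {suc k} (suc t) (suc a) = cong (true ∷_) (zipWith-∨-prefix t a)

admissible-prefix-0 : ∀ {k} (col : Vec Letter k) → admissible (prefix 0) col ≡ true
admissible-prefix-0 []        = refl
admissible-prefix-0 (c ∷ col) = admissible-prefix-0 col

admissible-column-≥ : ∀ {k} t a c → t ≤ a → admissible (prefix {k} t) (column a c) ≡ true
admissible-column-≥ {zero}  t       a       c _         = refl
admissible-column-≥ {suc k} zero    a       c _         = admissible-prefix-0 (column {suc k} a c)
admissible-column-≥ {suc k} (suc t) (suc a) c (s≤s t≤a) = admissible-column-≥ {k} t a c t≤a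

admissible-column-0 : ∀ {k} (ss : Vec Bool k) a → admissible ss (column a 0) ≡ true
admissible-column-0 []           a       = refl
admissible-column-0 (true  ∷ ss) (suc a) = admissible-column-0 ss a
admissible-column-0 (false ∷ ss) (suc a) = admissible-column-0 ss a
admissible-column-0 (true  ∷ ss) zero    = admissible-column-0 ss zero
admissible-column-0 (false ∷ ss) zero    = admissible-column-0 ss zero

admissible-column-< : ∀ {k} t a c → a < t → t ≤ k → admissible (prefix {k} t) (column a (suc c)) ≡ false
admissible-column-< {suc k} (suc t) zero    c _         _         = refl
admissible-column-< {suc k} (suc t) (suc a) c (s≤s a<t) (s≤s t≤k) = admissible-column-< t a c a<t t≤k

#admissible-≥ : ∀ k t a → t ≤ a → ∑[ c < suc k ∸ a ] 𝟙 (admissible (prefix {k} t) (column a c)) ≡ suc k ∸ a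
#admissible-≥ k t a t≤a =
  trans (∑<-cong (suc k ∸ a) (λ c _ → cong 𝟙 (admissible-column-≥ {k} t a c t≤a)))
        (trans (∑<-const (suc k ∸ a) 1) (ℕ.*-identityʳ _))

#admissible-< : ∀ k t a → a < t → t ≤ k → ∑[ c < suc k ∸ a ] 𝟙 (admissible (prefix {k} t) (column a c)) ≡ 1
#admissible-< k t a a<t t≤k = begin
  ∑[ c < suc k ∸ a ] 𝟙 (admissible (prefix {k} t) (column a c))
    ≡⟨ cong (λ m → ∑[ c < m ] 𝟙 (admissible (prefix {k} t) (column a c))) (ℕ.+-∸-assoc 1 a≤k) ⟩
  𝟙 (admissible (prefix {k} t) (column a 0)) + ∑[ c < k ∸ a ] 𝟙 (admissible (prefix {k} t) (column a (suc c)))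
    ≡⟨ cong₂ _+_ (cong 𝟙 (admissible-column-0 (prefix {k} t) a))
                 (∑<-vanishing (k ∸ a) (λ c _ → cong 𝟙 (admissible-column-< {k} t a c a<t t≤k))) ⟩
  1 ∎
  where
  open ≡-Reasoning
  a≤k = ℕ.<⇒≤ (ℕ.<-≤-trans a<t t≤k)

#no2-column : ∀ k a → a ≤ k → ∑[ c < suc k ∸ a ] 𝟙 (no2 (column {k} a c)) ≡ 1
#no2-column zero    zero    _         = refl
#no2-column (suc k) (suc a) (s≤s a≤k) = #no2-column k a a≤k
#no2-column (suc k) zero    _         = #no2-column k zero z≤n

chainsAfter-prefix-suc : ∀ k n t → t ≤ k →
  chainsAfter (suc n) (prefix {k} t)
    ≡ t * chainsAfter n (prefix {k} t)
      + ∑[ i < suc k ∸ t ] ((suc k ∸ (t + i)) * chainsAfter n (prefix {k} (t + i)))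
chainsAfter-prefix-suc k n t t≤k = begin
  chainsAfter (suc n) (prefix {k} t)
    ≡⟨ chainsAfter-suc n (prefix {k} t) ⟩
  ∑[ col ∈ tuples k letters ] (𝟙 (ascending col) * ψ col)
    ≡⟨ ∑-ascending k ψ ⟩
  ∑[ a < suc k ] ∑[ c < suc k ∸ a ] ψ (column a c)
    ≡⟨ ∑<-cong (suc k) (λ a _ → trans (∑<-cong (suc k ∸ a) (λ c _ → cong (λ ss → 𝟙 (adm a c) * H′ ss) (mask a c)))
                                      (∑<-*ʳ (suc k ∸ a) (H (t ⊔ a)) (λ c → 𝟙 (adm a c)))) ⟩
  ∑[ a < suc k ] (count a * H (t ⊔ a))
    ≡⟨ cong (λ m → ∑[ a < m ] (count a * H (t ⊔ a))) (sym (ℕ.m+[n∸m]≡n (ℕ.m≤n⇒m≤1+n t≤k))) ⟩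
  ∑[ a < t + (suc k ∸ t) ] (count a * H (t ⊔ a))
    ≡⟨ ∑<-split t (suc k ∸ t) _ ⟩
  ∑[ a < t ] (count a * H (t ⊔ a)) + ∑[ i < suc k ∸ t ] (count (t + i) * H (t ⊔ (t + i)))
    ≡⟨ cong₂ _+_ (∑<-cong t (λ a a<t → cong₂ _*_ (#admissible-< k t a a<t t≤k) (cong H (ℕ.m≥n⇒m⊔n≡m (ℕ.<⇒≤ a<t)))))
                 (∑<-cong (suc k ∸ t) (λ i _ → cong₂ _*_ (#admissible-≥ k t (t + i) (ℕ.m≤m+n t i))
                                                         (cong H (ℕ.m≤n⇒m⊔n≡n (ℕ.m≤m+n t i))))) ⟩
  ∑[ a < t ] (1 * H t) + ∑[ i < suc k ∸ t ] ((suc k ∸ (t + i)) * H (t + i))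
    ≡⟨ cong (_+ ∑[ i < suc k ∸ t ] ((suc k ∸ (t + i)) * H (t + i)))
            (trans (∑<-const t (1 * H t)) (cong (t *_) (ℕ.*-identityˡ (H t)))) ⟩
  t * H t + ∑[ i < suc k ∸ t ] ((suc k ∸ (t + i)) * H (t + i)) ∎
  where
  open ≡-Reasoning
  H′ : Vec Bool k → ℕ
  H′ = chainsAfter n
  H : ℕ → ℕ
  H a = H′ (prefix a)
  ψ : Vec Letter k → ℕ
  ψ col = 𝟙 (admissible (prefix t) col) * H′ (Vec.zipWith _∨_ (prefix t) (Vec.map is0 col))
  adm : ℕ → ℕ → Bool
  adm a c = admissible (prefix {k} t) (column a c)
  count : ℕ → ℕ
  count a = ∑[ c < suc k ∸ a ] 𝟙 (adm a c)
  mask : ∀ a c → Vec.zipWith _∨_ (prefix {k} t) (Vec.map is0 (column a c)) ≡ prefix (t ⊔ a)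
  mask a c = trans (cong (Vec.zipWith _∨_ (prefix t)) (map-is0-column a c)) (zipWith-∨-prefix t a)

-- Indexed by the number d of rows that have not yet seen a 0.
chainsUnseen : ℕ → ℕ → ℕ → ℕ
chainsUnseen k n d = chainsAfter n (prefix {k} (k ∸ d))

[k∸d]+[d∸j]≡k∸j : ∀ {k d j} → d ≤ k → j ≤ d → (k ∸ d) + (d ∸ j) ≡ k ∸ j
[k∸d]+[d∸j]≡k∸j {k} {d} {j} d≤k j≤d =
  trans (sym (ℕ.+-∸-assoc (k ∸ d) j≤d)) (cong (_∸ j) (ℕ.m∸n+n≡m d≤k))

[1+k]∸[k∸j]≡1+j : ∀ {k j} → j ≤ k → suc k ∸ (k ∸ j) ≡ suc j
[1+k]∸[k∸j]≡1+j {k} {j} j≤k = trans (ℕ.+-∸-assoc 1 (ℕ.m∸n≤m k j)) (cong suc (ℕ.m∸[m∸n]≡n j≤k))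

chainsUnseen-suc : ∀ k n d → d ≤ k →
  chainsUnseen k (suc n) d ≡ suc k * chainsUnseen k n d + ∑[ j < d ] (suc j * chainsUnseen k n j)
chainsUnseen-suc k n d d≤k = begin
  chainsAfter (suc n) (prefix {k} t)
    ≡⟨ chainsAfter-prefix-suc k n t (ℕ.m∸n≤m k d) ⟩
  t * U d + ∑[ i < suc k ∸ t ] g (t + i)
    ≡⟨ cong (λ m → t * U d + ∑[ i < m ] g (t + i)) ([1+k]∸[k∸j]≡1+j d≤k) ⟩
  t * U d + ∑[ i < suc d ] g (t + i)
    ≡⟨ cong (_+_ (t * U d)) (∑<-reverse (suc d) (λ i → g (t + i))) ⟩
  t * U d + ∑[ j < suc d ] g (t + (d ∸ j))
    ≡⟨ cong (_+_ (t * U d)) (∑<-cong (suc d) (λ j j<1+d → unshift j (ℕ.≤-pred j<1+d))) ⟩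
  t * U d + ∑[ j < suc d ] (suc j * U j)
    ≡⟨ cong (_+_ (t * U d)) (∑<-snoc d (λ j → suc j * U j)) ⟩
  t * U d + (∑[ j < d ] (suc j * U j) + suc d * U d)
    ≡⟨ solve 4 (λ T D u s → T :* u :+ (s :+ (con 1 :+ D) :* u) := (T :+ (con 1 :+ D)) :* u :+ s)
         refl t d (U d) (∑[ j < d ] (suc j * U j)) ⟩
  (t + suc d) * U d + ∑[ j < d ] (suc j * U j)
    ≡⟨ cong (λ m → m * U d + ∑[ j < d ] (suc j * U j)) (trans (ℕ.+-suc t d) (cong suc (ℕ.m∸n+n≡m d≤k))) ⟩
  suc k * U d + ∑[ j < d ] (suc j * U j) ∎
  where
  open ≡-Reasoning
  t = k ∸ d
  U : ℕ → ℕ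
  U = chainsUnseen k n
  g : ℕ → ℕ
  g a = (suc k ∸ a) * chainsAfter n (prefix {k} a)
  unshift : ∀ j → j ≤ d → g (t + (d ∸ j)) ≡ suc j * U j
  unshift j j≤d = trans (cong g ([k∸d]+[d∸j]≡k∸j d≤k j≤d))
                        (cong (_* U j) ([1+k]∸[k∸j]≡1+j (ℕ.≤-trans j≤d d≤k)))

chainsAfter-0 : ∀ {k} (ss : Vec Bool k) → chainsAfter 0 ss ≡ 1
chainsAfter-0 {k} ss = trans (∑-tuples-singleton k [] _) (cong 𝟙 (cong₂ _∧_ (chain k) (valid ss)))
  where
  chain : ∀ k → isChain (replicate k ([] {A = Letter})) ≡ true
  chain zero          = refl
  chain (suc zero)    = refl
  chain (suc (suc k)) = chain (suc k)
  valid : ∀ {k} (ss : Vec Bool k) → allValid ss (replicate k []) ≡ true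
  valid []       = refl
  valid (s ∷ ss) = valid ss

numChains-suc-unseen : ∀ m k → numChains (suc m) k ≡ ∑[ d < suc k ] chainsUnseen k m d
numChains-suc-unseen m k = begin
  numChains (suc m) k
    ≡⟨ numChains-suc m k ⟩
  ∑[ col ∈ tuples k letters ] (𝟙 (ascending col) * ψ col)
    ≡⟨ ∑-ascending k ψ ⟩
  ∑[ a < suc k ] ∑[ c < suc k ∸ a ] ψ (column a c)
    ≡⟨ ∑<-cong (suc k) (λ a a<1+k → trans
         (∑<-cong (suc k ∸ a) (λ c _ → cong (λ ss → 𝟙 (no2 (column {k} a c)) * chainsAfter m ss) (map-is0-column {k} a c)))
         (trans (∑<-*ʳ (suc k ∸ a) _ (λ c → 𝟙 (no2 (column {k} a c))))
                (trans (cong (_* chainsAfter m (prefix {k} a)) (#no2-column k a (ℕ.≤-pred a<1+k)))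
                       (ℕ.*-identityˡ (chainsAfter m (prefix {k} a)))))) ⟩
  ∑[ a < suc k ] chainsAfter m (prefix {k} a)
    ≡⟨ ∑<-reverse (suc k) (λ a → chainsAfter m (prefix {k} a)) ⟩
  ∑[ d < suc k ] chainsUnseen k m d ∎
  where
  open ≡-Reasoning
  ψ : Vec Letter k → ℕ
  ψ col = 𝟙 (no2 col) * chainsAfter m (Vec.map is0 col)

-- Solving the recurrence

-- Λ r = Lʳ 1 for the operator (L f) d = Σ_{j<d} (j+1) f j.
Λ : ℕ → ℕ → ℕ
Λ zero    d = 1
Λ (suc r) d = ∑[ j < d ] (suc j * Λ r j)

Λ-< : ∀ r d → d < r → Λ r d ≡ 0
Λ-< (suc r) d d<1+r = ∑<-vanishing d (λ j j<d →
  trans (cong (suc j *_) (Λ-< r j (ℕ.<-≤-trans j<d (ℕ.≤-pred d<1+r)))) (ℕ.*-zeroʳ (suc j)))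

Λ-diag : ∀ r → Λ r r ≡ r !
Λ-diag zero    = refl
Λ-diag (suc r) = trans (∑<-snoc r (λ j → suc j * Λ r j))
  (cong₂ _+_ (∑<-vanishing r (λ j j<r → trans (cong (suc j *_) (Λ-< r j j<r)) (ℕ.*-zeroʳ (suc j))))
             (cong (suc r *_) (Λ-diag r)))

binomialSum : ℕ → ℕ → ℕ → ℕ
binomialSum K n d = ∑[ r < suc n ] ((n C r) * (K ^ (n ∸ r) * Λ r d))

module _ (K : ℕ) where

  ∑-weighted-binomialSum : ∀ n d →
    ∑[ j < d ] (suc j * binomialSum K n j) ≡ ∑[ r < suc n ] ((n C r) * (K ^ (n ∸ r) * Λ (suc r) d))
  ∑-weighted-binomialSum n d = begin
    ∑[ j < d ] (suc j * ∑[ r < suc n ] term r j)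
      ≡⟨ ∑<-cong d (λ j _ → sym (∑<-*ˡ (suc n) (suc j) (λ r → term r j))) ⟩
    ∑[ j < d ] ∑[ r < suc n ] (suc j * term r j)
      ≡⟨ ∑<-comm d (suc n) (λ j r → suc j * term r j) ⟩
    ∑[ r < suc n ] ∑[ j < d ] (suc j * term r j)
      ≡⟨ ∑<-cong (suc n) (λ r _ → begin
           ∑[ j < d ] (suc j * term r j)
             ≡⟨ ∑<-cong d (λ j _ → solve 4 (λ s c p f → s :* (c :* (p :* f)) := c :* (p :* (s :* f))) refl
                                          (suc j) (n C r) (K ^ (n ∸ r)) (Λ r j)) ⟩
           ∑[ j < d ] ((n C r) * (K ^ (n ∸ r) * (suc j * Λ r j)))
             ≡⟨ ∑<-*ˡ d (n C r) _ ⟩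
           (n C r) * ∑[ j < d ] (K ^ (n ∸ r) * (suc j * Λ r j))
             ≡⟨ cong ((n C r) *_) (∑<-*ˡ d (K ^ (n ∸ r)) _) ⟩
           (n C r) * (K ^ (n ∸ r) * Λ (suc r) d) ∎) ⟩
    ∑[ r < suc n ] ((n C r) * (K ^ (n ∸ r) * Λ (suc r) d)) ∎
    where
    open ≡-Reasoning
    term : ℕ → ℕ → ℕ
    term r j = (n C r) * (K ^ (n ∸ r) * Λ r j)

  *-binomialSum : ∀ n d →
    K * binomialSum K n d ≡ K ^ suc n + ∑[ r < suc n ] ((n C suc r) * (K ^ (n ∸ r) * Λ (suc r) d))
  *-binomialSum n d = begin
    K * (1 * (K ^ n * 1) + ∑[ r < n ] ((n C suc r) * (K ^ (n ∸ suc r) * Λ (suc r) d)))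
      ≡⟨ ℕ.*-distribˡ-+ K _ _ ⟩
    K * (1 * (K ^ n * 1)) + K * ∑[ r < n ] ((n C suc r) * (K ^ (n ∸ suc r) * Λ (suc r) d))
      ≡⟨ cong₂ _+_ (cong (K *_) (trans (ℕ.*-identityˡ _) (ℕ.*-identityʳ _))) (sym (∑<-*ˡ n K _)) ⟩
    K ^ suc n + ∑[ r < n ] (K * ((n C suc r) * (K ^ (n ∸ suc r) * Λ (suc r) d)))
      ≡⟨ cong (_+_ (K ^ suc n)) (∑<-cong n (λ r r<n → shift r r<n)) ⟩
    K ^ suc n + ∑[ r < n ] f r
      ≡⟨ cong (_+_ (K ^ suc n)) (sym (trans (∑<-snoc n f) (trans (cong (_+_ (∑< n f)) f-top) (ℕ.+-identityʳ (∑< n f))))) ⟩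
    K ^ suc n + ∑[ r < suc n ] f r ∎
    where
    open ≡-Reasoning
    f : ℕ → ℕ
    f r = (n C suc r) * (K ^ (n ∸ r) * Λ (suc r) d)
    f-top : f n ≡ 0
    f-top = cong (_* (K ^ (n ∸ n) * Λ (suc n) d)) (k>n⇒nCk≡0 (ℕ.n<1+n n))
    shift : ∀ r → r < n → K * ((n C suc r) * (K ^ (n ∸ suc r) * Λ (suc r) d)) ≡ f r
    shift r r<n = trans (solve 4 (λ k c p l → k :* (c :* (p :* l)) := c :* ((k :* p) :* l)) refl
                                 K (n C suc r) (K ^ (n ∸ suc r)) (Λ (suc r) d))
                        (cong (λ e → (n C suc r) * (K ^ e * Λ (suc r) d)) (sym (ℕ.+-∸-assoc 1 r<n)))

  binomialSum-suc : ∀ n d →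
    binomialSum K (suc n) d ≡ K * binomialSum K n d + ∑[ j < d ] (suc j * binomialSum K n j)
  binomialSum-suc n d = begin
    1 * (K ^ suc n * 1) + ∑[ r < suc n ] ((suc n C suc r) * g r)
      ≡⟨ cong₂ _+_ (trans (ℕ.*-identityˡ (K ^ suc n * 1)) (ℕ.*-identityʳ (K ^ suc n)))
                   (∑<-cong (suc n) (λ r _ → trans (cong (_* g r) (sym (nCk+nC[k+1]≡[n+1]C[k+1] n r)))
                                                   (ℕ.*-distribʳ-+ (g r) (n C r) (n C suc r)))) ⟩
    K ^ suc n + ∑[ r < suc n ] ((n C r) * g r + (n C suc r) * g r)
      ≡⟨ cong (_+_ (K ^ suc n)) (∑<-+ (suc n) (λ r → (n C r) * g r) (λ r → (n C suc r) * g r)) ⟩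
    K ^ suc n + (∑[ r < suc n ] ((n C r) * g r) + ∑[ r < suc n ] ((n C suc r) * g r))
      ≡⟨ solve 3 (λ p a b → p :+ (a :+ b) := (p :+ b) :+ a) refl
           (K ^ suc n) (∑[ r < suc n ] ((n C r) * g r)) (∑[ r < suc n ] ((n C suc r) * g r)) ⟩
    (K ^ suc n + ∑[ r < suc n ] ((n C suc r) * g r)) + ∑[ r < suc n ] ((n C r) * g r)
      ≡⟨ cong₂ _+_ (sym (*-binomialSum n d)) (sym (∑-weighted-binomialSum n d)) ⟩
    K * binomialSum K n d + ∑[ j < d ] (suc j * binomialSum K n j) ∎
    where
    open ≡-Reasoning
    g : ℕ → ℕ
    g r = K ^ (n ∸ r) * Λ (suc r) d

  recurrence-solution : ∀ k (h : ℕ → ℕ → ℕ) →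
    (∀ d → h 0 d ≡ 1) →
    (∀ n d → d ≤ k → h (suc n) d ≡ K * h n d + ∑[ j < d ] (suc j * h n j)) →
    ∀ n d → d ≤ k → h n d ≡ binomialSum K n d
  recurrence-solution k h h-0 h-suc zero    d d≤k = h-0 d
  recurrence-solution k h h-0 h-suc (suc n) d d≤k = begin
    h (suc n) d
      ≡⟨ h-suc n d d≤k ⟩
    K * h n d + ∑[ j < d ] (suc j * h n j)
      ≡⟨ cong₂ _+_ (cong (K *_) (IH d d≤k))
                   (∑<-cong d (λ j j<d → cong (suc j *_) (IH j (ℕ.≤-trans (ℕ.<⇒≤ j<d) d≤k)))) ⟩
    K * binomialSum K n d + ∑[ j < d ] (suc j * binomialSum K n j)
      ≡⟨ binomialSum-suc n d ⟨
    binomialSum K (suc n) d ∎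
    where
    open ≡-Reasoning
    IH : ∀ d → d ≤ k → h n d ≡ binomialSum K n d
    IH = recurrence-solution k h h-0 h-suc n

Γ : ℕ → ℕ → ℕ
Γ k r = ∑[ d < suc k ] Λ r d

Γ-> : ∀ k r → k < r → Γ k r ≡ 0
Γ-> k r k<r = ∑<-vanishing (suc k) (λ d d<1+k → Λ-< r d (ℕ.<-≤-trans d<1+k k<r))

Γ-diag : ∀ k → Γ k k ≡ k !
Γ-diag k = trans (∑<-snoc k (Λ k)) (cong₂ _+_ (∑<-vanishing k (Λ-< k)) (Λ-diag k))

chainsUnseen-closedForm : ∀ k n d → d ≤ k → chainsUnseen k n d ≡ binomialSum (suc k) n d
chainsUnseen-closedForm k = recurrence-solution (suc k) k (chainsUnseen k)
  (λ d → chainsAfter-0 (prefix {k} (k ∸ d))) (chainsUnseen-suc k)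

numChains-binomial : ∀ m k → numChains (suc m) k ≡ ∑[ r < suc m ] ((m C r) * (suc k ^ (m ∸ r) * Γ k r))
numChains-binomial m k = begin
  numChains (suc m) k
    ≡⟨ numChains-suc-unseen m k ⟩
  ∑[ d < suc k ] chainsUnseen k m d
    ≡⟨ ∑<-cong (suc k) (λ d d<1+k → chainsUnseen-closedForm k m d (ℕ.≤-pred d<1+k)) ⟩
  ∑[ d < suc k ] ∑[ r < suc m ] ((m C r) * (suc k ^ (m ∸ r) * Λ r d))
    ≡⟨ ∑<-comm (suc k) (suc m) (λ d r → (m C r) * (suc k ^ (m ∸ r) * Λ r d)) ⟩
  ∑[ r < suc m ] ∑[ d < suc k ] ((m C r) * (suc k ^ (m ∸ r) * Λ r d))
    ≡⟨ ∑<-cong (suc m) (λ r _ → trans (∑<-*ˡ (suc k) (m C r) (λ d → suc k ^ (m ∸ r) * Λ r d))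
                                      (cong ((m C r) *_) (∑<-*ˡ (suc k) (suc k ^ (m ∸ r)) (Λ r)))) ⟩
  ∑[ r < suc m ] ((m C r) * (suc k ^ (m ∸ r) * Γ k r)) ∎
  where open ≡-Reasoning

reducedCount : ℕ → ℕ → ℕ
reducedCount k m = ∑[ r < suc k ] ((m C r) * (suc k ^ (k ∸ r) * Γ k r))

^-shift : ∀ K k m r → r ≤ m → r ≤ k → K ^ k * K ^ (m ∸ r) ≡ K ^ m * K ^ (k ∸ r)
^-shift K k m r r≤m r≤k = begin
  K ^ k * K ^ (m ∸ r)     ≡⟨ ℕ.^-distribˡ-+-* K k (m ∸ r) ⟨
  K ^ (k + (m ∸ r))       ≡⟨ cong (K ^_) exponents ⟩
  K ^ (m + (k ∸ r))       ≡⟨ ℕ.^-distribˡ-+-* K m (k ∸ r) ⟩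
  K ^ m * K ^ (k ∸ r)     ∎
  where
  open ≡-Reasoning
  exponents : k + (m ∸ r) ≡ m + (k ∸ r)
  exponents = trans (sym (ℕ.+-∸-assoc k r≤m))
                    (trans (cong (_∸ r) (ℕ.+-comm k m)) (ℕ.+-∸-assoc m r≤k))

numChains-reducedCount : ∀ m k → suc k ^ k * numChains (suc m) k ≡ suc k ^ m * reducedCount k m
numChains-reducedCount m k = begin
  K ^ k * numChains (suc m) k
    ≡⟨ cong (K ^ k *_) (numChains-binomial m k) ⟩
  K ^ k * ∑[ r < suc m ] f r
    ≡⟨ ∑<-*ˡ (suc m) (K ^ k) f ⟨
  ∑[ r < suc m ] (K ^ k * f r)
    ≡⟨ ∑<-extend (suc m) k (λ r m<r → trans (cong (K ^ k *_) (f-C r m<r)) (ℕ.*-zeroʳ (K ^ k))) ⟨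
  ∑[ r < suc (m + k) ] (K ^ k * f r)
    ≡⟨ ∑<-cong (suc (m + k)) (λ r _ → termwise r) ⟩
  ∑[ r < suc (m + k) ] (K ^ m * g r)
    ≡⟨ cong (λ n → ∑[ r < suc n ] (K ^ m * g r)) (ℕ.+-comm m k) ⟩
  ∑[ r < suc (k + m) ] (K ^ m * g r)
    ≡⟨ ∑<-extend (suc k) m (λ r k<r → trans (cong (K ^ m *_) (g-Γ r k<r)) (ℕ.*-zeroʳ (K ^ m))) ⟩
  ∑[ r < suc k ] (K ^ m * g r)
    ≡⟨ ∑<-*ˡ (suc k) (K ^ m) g ⟩
  K ^ m * reducedCount k m ∎
  where
  open ≡-Reasoning
  K = suc k
  term : ℕ → ℕ → ℕ
  term e r = (m C r) * (K ^ (e ∸ r) * Γ k r)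
  f g : ℕ → ℕ
  f = term m
  g = term k
  term-C : ∀ e r → m < r → term e r ≡ 0
  term-C e r m<r = cong (_* (K ^ (e ∸ r) * Γ k r)) (k>n⇒nCk≡0 m<r)
  term-Γ : ∀ e r → k < r → term e r ≡ 0
  term-Γ e r k<r = trans (cong (λ γ → (m C r) * (K ^ (e ∸ r) * γ)) (Γ-> k r k<r))
                         (trans (cong ((m C r) *_) (ℕ.*-zeroʳ (K ^ (e ∸ r)))) (ℕ.*-zeroʳ (m C r)))
  f-C = term-C m
  g-Γ = term-Γ k
  both-zero : ∀ r → f r ≡ 0 → g r ≡ 0 → K ^ k * f r ≡ K ^ m * g r
  both-zero r f≡0 g≡0 = trans (cong (K ^ k *_) f≡0) (trans (ℕ.*-zeroʳ (K ^ k))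
                            (sym (trans (cong (K ^ m *_) g≡0) (ℕ.*-zeroʳ (K ^ m)))))
  termwise : ∀ r → K ^ k * f r ≡ K ^ m * g r
  termwise r with r ℕ.≤? m | r ℕ.≤? k
  ... | yes r≤m | yes r≤k =
    trans (solve 4 (λ P c Q γ → P :* (c :* (Q :* γ)) := c :* ((P :* Q) :* γ)) refl (K ^ k) (m C r) (K ^ (m ∸ r)) (Γ k r))
          (trans (cong (λ x → (m C r) * (x * Γ k r)) (^-shift K k m r r≤m r≤k))
                 (solve 4 (λ P c Q γ → c :* ((P :* Q) :* γ) := P :* (c :* (Q :* γ))) refl (K ^ m) (m C r) (K ^ (k ∸ r)) (Γ k r)))
  ... | no r≰m | _      = both-zero r (term-C m r (ℕ.≰⇒> r≰m)) (term-C k r (ℕ.≰⇒> r≰m))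
  ... | yes _  | no r≰k = both-zero r (term-Γ m r (ℕ.≰⇒> r≰k)) (term-Γ k r (ℕ.≰⇒> r≰k))

-- Passing to a polynomial over ℚ

[k+1]*[n+1]C[k+1]≡[n+1]*nCk : ∀ n k → suc k * (suc n C suc k) ≡ suc n * (n C k)
[k+1]*[n+1]C[k+1]≡[n+1]*nCk n       zero    = trans (ℕ.*-identityˡ _) (trans (nC1≡n (suc n)) (sym (ℕ.*-identityʳ (suc n))))
[k+1]*[n+1]C[k+1]≡[n+1]*nCk zero    (suc k) =
  trans (cong (suc (suc k) *_) (k>n⇒nCk≡0 {1} {suc (suc k)} (s≤s (s≤s z≤n))))
        (trans (ℕ.*-zeroʳ (suc (suc k))) (sym (cong (1 *_) (k>n⇒nCk≡0 {0} {suc k} (s≤s z≤n)))))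
[k+1]*[n+1]C[k+1]≡[n+1]*nCk (suc n) (suc k) = begin
  suc (suc k) * (suc (suc n) C suc (suc k))
    ≡⟨ cong (suc (suc k) *_) (nCk+nC[k+1]≡[n+1]C[k+1] (suc n) (suc k)) ⟨
  suc (suc k) * (X + Y)
    ≡⟨ solve 3 (λ k x y → (con 2 :+ k) :* (x :+ y) := x :+ (con 1 :+ k) :* x :+ (con 2 :+ k) :* y) refl k X Y ⟩
  X + suc k * X + suc (suc k) * Y
    ≡⟨ cong₂ (λ a b → X + a + b) ([k+1]*[n+1]C[k+1]≡[n+1]*nCk n k) ([k+1]*[n+1]C[k+1]≡[n+1]*nCk n (suc k)) ⟩
  X + suc n * (n C k) + suc n * (n C suc k)
    ≡⟨ solve 4 (λ x n a b → x :+ n :* a :+ n :* b := x :+ n :* (a :+ b)) refl X (suc n) (n C k) (n C suc k) ⟩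
  X + suc n * (n C k + n C suc k)
    ≡⟨ cong (λ c → X + suc n * c) (nCk+nC[k+1]≡[n+1]C[k+1] n k) ⟩
  suc (suc n) * X ∎
  where
  open ≡-Reasoning
  X = suc n C suc k
  Y = suc n C suc (suc k)

[k+1]*nC[k+1]+k*nCk≡n*nCk : ∀ n k → suc k * (n C suc k) + k * (n C k) ≡ n * (n C k)
[k+1]*nC[k+1]+k*nCk≡n*nCk zero    zero    = refl
[k+1]*nC[k+1]+k*nCk≡n*nCk zero    (suc k) =
  cong₂ _+_ (trans (cong (suc (suc k) *_) (k>n⇒nCk≡0 {0} {suc (suc k)} (s≤s z≤n))) (ℕ.*-zeroʳ (suc (suc k))))
            (trans (cong (suc k *_) (k>n⇒nCk≡0 {0} {suc k} (s≤s z≤n))) (ℕ.*-zeroʳ (suc k)))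
[k+1]*nC[k+1]+k*nCk≡n*nCk (suc n) zero    =
  trans (ℕ.+-identityʳ _) (trans (ℕ.*-identityˡ _) (trans (nC1≡n (suc n)) (sym (ℕ.*-identityʳ (suc n)))))
[k+1]*nC[k+1]+k*nCk≡n*nCk (suc n) (suc k) = begin
  suc (suc k) * (suc n C suc (suc k)) + suc k * (suc n C suc k)
    ≡⟨ cong₂ _+_ ([k+1]*[n+1]C[k+1]≡[n+1]*nCk n (suc k)) ([k+1]*[n+1]C[k+1]≡[n+1]*nCk n k) ⟩
  suc n * (n C suc k) + suc n * (n C k)
    ≡⟨ trans (ℕ.+-comm (suc n * (n C suc k)) _) (sym (ℕ.*-distribˡ-+ (suc n) (n C k) (n C suc k))) ⟩
  suc n * (n C k + n C suc k)
    ≡⟨ cong (suc n *_) (nCk+nC[k+1]≡[n+1]C[k+1] n k) ⟩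
  suc n * (suc n C suc k) ∎
  where open ≡-Reasoning

fromℕ≡mkℚ : ∀ n → fromℕ n ≡ mkℚ (+ n) 0 (Coprime.sym (Coprime.1-coprimeTo n))
fromℕ≡mkℚ n = ℚ.normalize-coprime (Coprime.sym (Coprime.1-coprimeTo n))

fromℕ-suc : ∀ n → fromℕ (suc n) ≡ 1ℚ ℚ.+ fromℕ n
fromℕ-suc n = trans (ℚ./-cong {p₁ = + suc n} {q₁ = 1} {p₂ = + 1 ℤ.+ (+ n ℤ.* + 1)} {q₂ = 1}
                              (cong (ℤ._+_ (+ 1)) (sym (ℤ.*-identityʳ (+ n)))) refl)
                    (cong (1ℚ ℚ.+_) (sym (fromℕ≡mkℚ n)))

fromℕ-+ : ∀ a b → fromℕ (a + b) ≡ fromℕ a ℚ.+ fromℕ b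
fromℕ-+ zero    b = sym (ℚ.+-identityˡ (fromℕ b))
fromℕ-+ (suc a) b = begin
  fromℕ (suc (a + b))                 ≡⟨ fromℕ-suc (a + b) ⟩
  1ℚ ℚ.+ fromℕ (a + b)                ≡⟨ cong (1ℚ ℚ.+_) (fromℕ-+ a b) ⟩
  1ℚ ℚ.+ (fromℕ a ℚ.+ fromℕ b)        ≡⟨ ℚ.+-assoc 1ℚ (fromℕ a) (fromℕ b) ⟨
  (1ℚ ℚ.+ fromℕ a) ℚ.+ fromℕ b        ≡⟨ cong (ℚ._+ fromℕ b) (fromℕ-suc a) ⟨
  fromℕ (suc a) ℚ.+ fromℕ b           ∎
  where open ≡-Reasoning

fromℕ-* : ∀ a b → fromℕ (a * b) ≡ fromℕ a ℚ.* fromℕ b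
fromℕ-* zero    b = sym (ℚ.*-zeroˡ (fromℕ b))
fromℕ-* (suc a) b = begin
  fromℕ (b + a * b)                   ≡⟨ fromℕ-+ b (a * b) ⟩
  fromℕ b ℚ.+ fromℕ (a * b)           ≡⟨ cong (fromℕ b ℚ.+_) (fromℕ-* a b) ⟩
  fromℕ b ℚ.+ fromℕ a ℚ.* fromℕ b     ≡⟨ solveℚ 2 (λ x y → y ⊕ x ⊗ y ≐ (conℚ 1ℚ ⊕ x) ⊗ y) refl
                                                 (fromℕ a) (fromℕ b) ⟩
  (1ℚ ℚ.+ fromℕ a) ℚ.* fromℕ b        ≡⟨ cong (ℚ._* fromℕ b) (fromℕ-suc a) ⟨
  fromℕ (suc a) ℚ.* fromℕ b           ∎
  where open ≡-Reasoning

fromℕ-^ : ∀ a n → fromℕ (a ^ n) ≡ powℚ (fromℕ a) n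
fromℕ-^ a zero    = refl
fromℕ-^ a (suc n) = trans (fromℕ-* a (a ^ n)) (cong (fromℕ a ℚ.*_) (fromℕ-^ a n))

1/[1+n]*[1+n]≡1 : ∀ n → (+ 1 / suc n) ℚ.* fromℕ (suc n) ≡ 1ℚ
1/[1+n]*[1+n]≡1 n =
  trans (cong₂ ℚ._*_ (ℚ.normalize-coprime (Coprime.1-coprimeTo (suc n))) (fromℕ≡mkℚ (suc n)))
        (ℚ.*-inverseˡ (mkℚ (+ suc n) 0 (Coprime.sym (Coprime.1-coprimeTo (suc n)))))

∑ℚ< : ℕ → (ℕ → ℚ) → ℚ
∑ℚ< zero    f = 0ℚ
∑ℚ< (suc n) f = f 0 ℚ.+ ∑ℚ< n (λ i → f (suc i))

syntax ∑ℚ< n (λ i → e) = ∑ℚ[ i < n ] e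

∑ℚ<-cong : ∀ n {f g : ℕ → ℚ} → (∀ i → i < n → f i ≡ g i) → ∑ℚ< n f ≡ ∑ℚ< n g
∑ℚ<-cong zero    f≗g = refl
∑ℚ<-cong (suc n) f≗g = cong₂ ℚ._+_ (f≗g 0 (s≤s z≤n)) (∑ℚ<-cong n (λ i i<n → f≗g (suc i) (s≤s i<n)))

∑ℚ<-vanishing : ∀ n {f : ℕ → ℚ} → (∀ i → i < n → f i ≡ 0ℚ) → ∑ℚ< n f ≡ 0ℚ
∑ℚ<-vanishing zero    f≗0 = refl
∑ℚ<-vanishing (suc n) f≗0 = trans (cong₂ ℚ._+_ (f≗0 0 (s≤s z≤n)) (∑ℚ<-vanishing n (λ i i<n → f≗0 (suc i) (s≤s i<n))))
                                  (ℚ.+-identityˡ 0ℚ)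

∑ℚ<-snoc : ∀ n f → ∑ℚ< (suc n) f ≡ ∑ℚ< n f ℚ.+ f n
∑ℚ<-snoc zero    f = trans (ℚ.+-identityʳ (f 0)) (sym (ℚ.+-identityˡ (f 0)))
∑ℚ<-snoc (suc n) f = trans (cong (f 0 ℚ.+_) (∑ℚ<-snoc n (λ i → f (suc i)))) (sym (ℚ.+-assoc (f 0) _ _))

fromℕ-∑< : ∀ n f → fromℕ (∑< n f) ≡ ∑ℚ[ i < n ] fromℕ (f i)
fromℕ-∑< zero    f = refl
fromℕ-∑< (suc n) f = trans (fromℕ-+ (f 0) _) (cong (fromℕ (f 0) ℚ.+_) (fromℕ-∑< n (λ i → f (suc i))))

-- Coefficient sequences; eval n p only reads the first n coefficients.
Poly : Set
Poly = ℕ → ℚ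

coeffs : ∀ n → Poly → Vec ℚ n
coeffs zero    p = []
coeffs (suc n) p = p 0 ∷ coeffs n (λ i → p (suc i))

eval : ℕ → Poly → ℚ → ℚ
eval n p = lowerPart (coeffs n p)

eval-snoc : ∀ n p x → eval (suc n) p x ≡ eval n p x ℚ.+ powℚ x n ℚ.* p n
eval-snoc zero    p x = solveℚ 2 (λ a x → a ⊕ x ⊗ conℚ 0ℚ ≐ conℚ 0ℚ ⊕ conℚ 1ℚ ⊗ a) refl (p 0) x
eval-snoc (suc n) p x =
  trans (cong (λ e → p 0 ℚ.+ x ℚ.* e) (eval-snoc n (λ i → p (suc i)) x))
        (solveℚ 5 (λ a x e y b → a ⊕ x ⊗ (e ⊕ y ⊗ b) ≐ (a ⊕ x ⊗ e) ⊕ (x ⊗ y) ⊗ b) refl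
                (p 0) x (eval n (λ i → p (suc i)) x) (powℚ x n) (p (suc n)))

eval-+ : ∀ n p q x → eval n (λ i → p i ℚ.+ q i) x ≡ eval n p x ℚ.+ eval n q x
eval-+ zero    p q x = sym (ℚ.+-identityˡ 0ℚ)
eval-+ (suc n) p q x =
  trans (cong (λ e → p 0 ℚ.+ q 0 ℚ.+ x ℚ.* e) (eval-+ n (λ i → p (suc i)) (λ i → q (suc i)) x))
        (solveℚ 5 (λ a b x c d → a ⊕ b ⊕ x ⊗ (c ⊕ d) ≐ (a ⊕ x ⊗ c) ⊕ (b ⊕ x ⊗ d)) refl
                (p 0) (q 0) x (eval n (λ i → p (suc i)) x) (eval n (λ i → q (suc i)) x))

eval-* : ∀ n c p x → eval n (λ i → c ℚ.* p i) x ≡ c ℚ.* eval n p x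
eval-* zero    c p x = sym (ℚ.*-zeroʳ c)
eval-* (suc n) c p x =
  trans (cong (λ e → c ℚ.* p 0 ℚ.+ x ℚ.* e) (eval-* n c (λ i → p (suc i)) x))
        (solveℚ 4 (λ c a x e → c ⊗ a ⊕ x ⊗ (c ⊗ e) ≐ c ⊗ (a ⊕ x ⊗ e)) refl c (p 0) x (eval n (λ i → p (suc i)) x))

eval-0 : ∀ n x → eval n (λ _ → 0ℚ) x ≡ 0ℚ
eval-0 zero    x = refl
eval-0 (suc n) x = trans (cong (λ e → 0ℚ ℚ.+ x ℚ.* e) (eval-0 n x))
                         (solveℚ 1 (λ x → conℚ 0ℚ ⊕ x ⊗ conℚ 0ℚ ≐ conℚ 0ℚ) refl x)

eval-∑ : ∀ n R (ps : ℕ → Poly) x → eval n (λ i → ∑ℚ[ r < R ] ps r i) x ≡ ∑ℚ[ r < R ] eval n (ps r) x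
eval-∑ n zero    ps x = eval-0 n x
eval-∑ n (suc R) ps x = trans (eval-+ n (ps 0) (λ i → ∑ℚ[ r < R ] ps (suc r) i) x)
                              (cong (eval n (ps 0) x ℚ.+_) (eval-∑ n R (λ r → ps (suc r)) x))

eval-stable : ∀ n j p x → (∀ i → n ≤ i → p i ≡ 0ℚ) → eval (j + n) p x ≡ eval n p x
eval-stable n zero    p x p≗0 = refl
eval-stable n (suc j) p x p≗0 = begin
  eval (suc (j + n)) p x
    ≡⟨ eval-snoc (j + n) p x ⟩
  eval (j + n) p x ℚ.+ powℚ x (j + n) ℚ.* p (j + n)
    ≡⟨ cong (λ c → eval (j + n) p x ℚ.+ powℚ x (j + n) ℚ.* c) (p≗0 (j + n) (ℕ.m≤n+m n j)) ⟩
  eval (j + n) p x ℚ.+ powℚ x (j + n) ℚ.* 0ℚ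
    ≡⟨ solveℚ 2 (λ e y → e ⊕ y ⊗ conℚ 0ℚ ≐ e) refl (eval (j + n) p x) (powℚ x (j + n)) ⟩
  eval (j + n) p x
    ≡⟨ eval-stable n j p x p≗0 ⟩
  eval n p x ∎
  where open ≡-Reasoning

mulX : Poly → Poly
mulX p zero    = 0ℚ
mulX p (suc i) = p i

mulLinear : ℚ → Poly → Poly
mulLinear c p i = mulX p i ℚ.+ (ℚ.- c) ℚ.* p i

eval-mulLinear : ∀ n c p x → eval (suc n) (mulLinear c p) x ≡ x ℚ.* eval n p x ℚ.+ (ℚ.- c) ℚ.* eval (suc n) p x
eval-mulLinear n c p x = trans (eval-+ (suc n) (mulX p) (λ i → (ℚ.- c) ℚ.* p i) x)
                               (cong₂ ℚ._+_ (ℚ.+-identityˡ (x ℚ.* eval n p x)) (eval-* (suc n) (ℚ.- c) p x))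

-- The coefficients of (x - 1)(x - 2)⋯(x - r)/r!, whose value at x = m + 1 is m C r.
binomialPoly : ℕ → Poly
binomialPoly zero    zero    = 1ℚ
binomialPoly zero    (suc i) = 0ℚ
binomialPoly (suc r) i       = (+ 1 / suc r) ℚ.* mulLinear (fromℕ (suc r)) (binomialPoly r) i

binomialPoly-> : ∀ r i → r < i → binomialPoly r i ≡ 0ℚ
binomialPoly-> zero    (suc i) _         = refl
binomialPoly-> (suc r) (suc i) (s≤s r<i) =
  trans (cong₂ (λ a b → (+ 1 / suc r) ℚ.* (a ℚ.+ (ℚ.- fromℕ (suc r)) ℚ.* b))
               (binomialPoly-> r i r<i) (binomialPoly-> r (suc i) (ℕ.m≤n⇒m≤1+n r<i)))
        (solveℚ 2 (λ v c → v ⊗ (conℚ 0ℚ ⊕ (⊝ c) ⊗ conℚ 0ℚ) ≐ conℚ 0ℚ) refl (+ 1 / suc r) (fromℕ (suc r)))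

binomialPoly-diag : ∀ r → fromℕ (r !) ℚ.* binomialPoly r r ≡ 1ℚ
binomialPoly-diag zero    = refl
binomialPoly-diag (suc r) = begin
  fromℕ (suc r * r !) ℚ.* (v ℚ.* (binomialPoly r r ℚ.+ (ℚ.- s) ℚ.* binomialPoly r (suc r)))
    ≡⟨ cong₂ (λ a b → a ℚ.* (v ℚ.* (binomialPoly r r ℚ.+ (ℚ.- s) ℚ.* b)))
             (fromℕ-* (suc r) (r !)) (binomialPoly-> r (suc r) (ℕ.n<1+n r)) ⟩
  (s ℚ.* fromℕ (r !)) ℚ.* (v ℚ.* (binomialPoly r r ℚ.+ (ℚ.- s) ℚ.* 0ℚ))
    ≡⟨ solveℚ 4 (λ s f v b → (s ⊗ f) ⊗ (v ⊗ (b ⊕ (⊝ s) ⊗ conℚ 0ℚ)) ≐ (v ⊗ s) ⊗ (f ⊗ b)) refl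
              s (fromℕ (r !)) v (binomialPoly r r) ⟩
  (v ℚ.* s) ℚ.* (fromℕ (r !) ℚ.* binomialPoly r r)
    ≡⟨ cong₂ ℚ._*_ (1/[1+n]*[1+n]≡1 r) (binomialPoly-diag r) ⟩
  1ℚ ∎
  where
  open ≡-Reasoning
  v = + 1 / suc r
  s = fromℕ (suc r)

eval-binomialPoly : ∀ r m → eval (suc r) (binomialPoly r) (fromℕ (suc m)) ≡ fromℕ (m C r)
eval-binomialPoly zero    m = solveℚ 1 (λ x → conℚ 1ℚ ⊕ x ⊗ conℚ 0ℚ ≐ conℚ 1ℚ) refl (fromℕ (suc m))
eval-binomialPoly (suc r) m = begin
  eval (suc (suc r)) (λ i → v ℚ.* mulLinear s P i) x
    ≡⟨ eval-* (suc (suc r)) v (mulLinear s P) x ⟩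
  v ℚ.* eval (suc (suc r)) (mulLinear s P) x
    ≡⟨ cong (v ℚ.*_) (eval-mulLinear (suc r) s P x) ⟩
  v ℚ.* (x ℚ.* E ℚ.+ (ℚ.- s) ℚ.* eval (suc (suc r)) P x)
    ≡⟨ cong (λ e → v ℚ.* (x ℚ.* E ℚ.+ (ℚ.- s) ℚ.* e))
            (trans (eval-snoc (suc r) P x) (cong (λ b → E ℚ.+ powℚ x (suc r) ℚ.* b) (binomialPoly-> r (suc r) (ℕ.n<1+n r)))) ⟩
  v ℚ.* (x ℚ.* E ℚ.+ (ℚ.- s) ℚ.* (E ℚ.+ powℚ x (suc r) ℚ.* 0ℚ))
    ≡⟨ cong (λ e → v ℚ.* (x ℚ.* e ℚ.+ (ℚ.- s) ℚ.* (e ℚ.+ powℚ x (suc r) ℚ.* 0ℚ))) (eval-binomialPoly r m) ⟩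
  v ℚ.* (x ℚ.* c₀ ℚ.+ (ℚ.- s) ℚ.* (c₀ ℚ.+ powℚ x (suc r) ℚ.* 0ℚ))
    ≡⟨ cong₂ (λ a b → v ℚ.* (a ℚ.* c₀ ℚ.+ (ℚ.- b) ℚ.* (c₀ ℚ.+ powℚ x (suc r) ℚ.* 0ℚ)))
             (fromℕ-suc m) (fromℕ-suc r) ⟩
  v ℚ.* ((1ℚ ℚ.+ M) ℚ.* c₀ ℚ.+ (ℚ.- (1ℚ ℚ.+ R)) ℚ.* (c₀ ℚ.+ powℚ x (suc r) ℚ.* 0ℚ))
    ≡⟨ solveℚ 5 (λ v m c r p → v ⊗ ((conℚ 1ℚ ⊕ m) ⊗ c ⊕ (⊝ (conℚ 1ℚ ⊕ r)) ⊗ (c ⊕ p ⊗ conℚ 0ℚ))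
                              ≐ v ⊗ (m ⊗ c ⊕ (⊝ (r ⊗ c))))
              refl v M c₀ R (powℚ x (suc r)) ⟩
  v ℚ.* (M ℚ.* c₀ ℚ.+ (ℚ.- (R ℚ.* c₀)))
    ≡⟨ cong (λ y → v ℚ.* (y ℚ.+ (ℚ.- (R ℚ.* c₀)))) absorption ⟨
  v ℚ.* ((s ℚ.* c₁ ℚ.+ R ℚ.* c₀) ℚ.+ (ℚ.- (R ℚ.* c₀)))
    ≡⟨ solveℚ 5 (λ v s c′ r c → v ⊗ ((s ⊗ c′ ⊕ r ⊗ c) ⊕ (⊝ (r ⊗ c))) ≐ (v ⊗ s) ⊗ c′) refl v s c₁ R c₀ ⟩
  (v ℚ.* s) ℚ.* c₁
    ≡⟨ trans (cong (ℚ._* c₁) (1/[1+n]*[1+n]≡1 r)) (ℚ.*-identityˡ c₁) ⟩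
  c₁ ∎
  where
  open ≡-Reasoning
  v = + 1 / suc r
  s = fromℕ (suc r)
  x = fromℕ (suc m)
  M = fromℕ m
  R = fromℕ r
  P = binomialPoly r
  E = eval (suc r) P x
  c₀ = fromℕ (m C r)
  c₁ = fromℕ (m C suc r)
  absorption : s ℚ.* c₁ ℚ.+ R ℚ.* c₀ ≡ M ℚ.* c₀
  absorption = begin
    s ℚ.* c₁ ℚ.+ R ℚ.* c₀                          ≡⟨ cong₂ ℚ._+_ (fromℕ-* (suc r) (m C suc r)) (fromℕ-* r (m C r)) ⟨
    fromℕ (suc r * (m C suc r)) ℚ.+ fromℕ (r * (m C r)) ≡⟨ fromℕ-+ (suc r * (m C suc r)) (r * (m C r)) ⟨
    fromℕ (suc r * (m C suc r) + r * (m C r))     ≡⟨ cong fromℕ ([k+1]*nC[k+1]+k*nCk≡n*nCk m r) ⟩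
    fromℕ (m * (m C r))                           ≡⟨ fromℕ-* m (m C r) ⟩
    M ℚ.* c₀                                       ∎

weight : ℕ → ℕ → ℚ
weight k r = fromℕ (suc k ^ (k ∸ r) * Γ k r)

reducedPoly : ℕ → Poly
reducedPoly k i = ∑ℚ[ r < suc k ] (weight k r ℚ.* binomialPoly r i)

reducedPoly-top : ∀ k → reducedPoly k k ≡ 1ℚ
reducedPoly-top k = begin
  ∑ℚ[ r < suc k ] (weight k r ℚ.* binomialPoly r k)
    ≡⟨ ∑ℚ<-snoc k (λ r → weight k r ℚ.* binomialPoly r k) ⟩
  ∑ℚ[ r < k ] (weight k r ℚ.* binomialPoly r k) ℚ.+ weight k k ℚ.* binomialPoly k k
    ≡⟨ cong₂ ℚ._+_ (∑ℚ<-vanishing k (λ r r<k → trans (cong (weight k r ℚ.*_) (binomialPoly-> r k r<k)) (ℚ.*-zeroʳ (weight k r))))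
                   (cong (ℚ._* binomialPoly k k) weight-diag) ⟩
  0ℚ ℚ.+ fromℕ (k !) ℚ.* binomialPoly k k
    ≡⟨ trans (ℚ.+-identityˡ _) (binomialPoly-diag k) ⟩
  1ℚ ∎
  where
  open ≡-Reasoning
  weight-diag : weight k k ≡ fromℕ (k !)
  weight-diag = cong fromℕ (trans (cong (λ e → suc k ^ e * Γ k k) (ℕ.n∸n≡0 k))
                                  (trans (ℕ.*-identityˡ (Γ k k)) (Γ-diag k)))

eval-reducedPoly : ∀ k m → eval (suc k) (reducedPoly k) (fromℕ (suc m)) ≡ fromℕ (reducedCount k m)
eval-reducedPoly k m = begin
  eval (suc k) (reducedPoly k) x
    ≡⟨ eval-∑ (suc k) (suc k) (λ r i → weight k r ℚ.* binomialPoly r i) x ⟩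
  ∑ℚ[ r < suc k ] eval (suc k) (λ i → weight k r ℚ.* binomialPoly r i) x
    ≡⟨ ∑ℚ<-cong (suc k) (λ r r<1+k → trans (eval-* (suc k) (weight k r) (binomialPoly r) x)
                                           (cong (weight k r ℚ.*_) (eval-binomialPoly′ r (ℕ.≤-pred r<1+k)))) ⟩
  ∑ℚ[ r < suc k ] (weight k r ℚ.* fromℕ (m C r))
    ≡⟨ ∑ℚ<-cong (suc k) (λ r _ → trans (ℚ.*-comm (weight k r) (fromℕ (m C r)))
                                       (sym (fromℕ-* (m C r) (suc k ^ (k ∸ r) * Γ k r)))) ⟩
  ∑ℚ[ r < suc k ] fromℕ ((m C r) * (suc k ^ (k ∸ r) * Γ k r))
    ≡⟨ fromℕ-∑< (suc k) (λ r → (m C r) * (suc k ^ (k ∸ r) * Γ k r)) ⟨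
  fromℕ (reducedCount k m) ∎
  where
  open ≡-Reasoning
  x = fromℕ (suc m)
  eval-binomialPoly′ : ∀ r → r ≤ k → eval (suc k) (binomialPoly r) x ≡ fromℕ (m C r)
  eval-binomialPoly′ r r≤k = begin
    eval (suc k) (binomialPoly r) x
      ≡⟨ cong (λ n → eval n (binomialPoly r) x) (trans (ℕ.+-suc (k ∸ r) r) (cong suc (ℕ.m∸n+n≡m r≤k))) ⟨
    eval ((k ∸ r) + suc r) (binomialPoly r) x
      ≡⟨ eval-stable (suc r) (k ∸ r) (binomialPoly r) x (binomialPoly-> r) ⟩
    eval (suc r) (binomialPoly r) x
      ≡⟨ eval-binomialPoly r m ⟩
    fromℕ (m C r) ∎

monicEval-coeffs : ∀ k p x → p k ≡ 1ℚ → monicEval (coeffs k p) x ≡ eval (suc k) p x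
monicEval-coeffs k p x pₖ≡1 = sym (begin
  eval (suc k) p x                         ≡⟨ eval-snoc k p x ⟩
  eval k p x ℚ.+ powℚ x k ℚ.* p k          ≡⟨ cong (λ c → eval k p x ℚ.+ powℚ x k ℚ.* c) pₖ≡1 ⟩
  eval k p x ℚ.+ powℚ x k ℚ.* 1ℚ           ≡⟨ solveℚ 2 (λ e y → e ⊕ y ⊗ conℚ 1ℚ ≐ y ⊕ e) refl (eval k p x) (powℚ x k) ⟩
  powℚ x k ℚ.+ eval k p x                  ∎)
  where open ≡-Reasoning

powSuc-⊖ : ∀ k a b → powSuc k (a ⊖ b) ≡ powℚ (+ 1 / suc k) b ℚ.* powℚ (fromℕ (suc k)) a
powSuc-⊖ k a       zero    = trans (cong (powSuc k) (ℤ.⊖-≥ {a} z≤n)) (sym (ℚ.*-identityˡ (powℚ (fromℕ (suc k)) a)))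
powSuc-⊖ k zero    (suc b) =
  trans (cong (powSuc k) (ℤ.⊖-< {0} {suc b} (s≤s z≤n))) (sym (ℚ.*-identityʳ (powℚ (+ 1 / suc k) (suc b))))
powSuc-⊖ k (suc a) (suc b) = begin
  powSuc k (suc a ⊖ suc b)
    ≡⟨ cong (powSuc k) (ℤ.[1+m]⊖[1+n]≡m⊖n a b) ⟩
  powSuc k (a ⊖ b)
    ≡⟨ powSuc-⊖ k a b ⟩
  powℚ κ⁻¹ b ℚ.* powℚ κ a
    ≡⟨ ℚ.*-identityˡ _ ⟨
  1ℚ ℚ.* (powℚ κ⁻¹ b ℚ.* powℚ κ a)
    ≡⟨ cong (ℚ._* (powℚ κ⁻¹ b ℚ.* powℚ κ a)) (1/[1+n]*[1+n]≡1 k) ⟨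
  (κ⁻¹ ℚ.* κ) ℚ.* (powℚ κ⁻¹ b ℚ.* powℚ κ a)
    ≡⟨ solveℚ 4 (λ i c p q → (i ⊗ c) ⊗ (p ⊗ q) ≐ (i ⊗ p) ⊗ (c ⊗ q)) refl κ⁻¹ κ (powℚ κ⁻¹ b) (powℚ κ a) ⟩
  powℚ κ⁻¹ (suc b) ℚ.* powℚ κ (suc a) ∎
  where
  open ≡-Reasoning
  κ = fromℕ (suc k)
  κ⁻¹ = + 1 / suc k

numChains-ℚ : ∀ m k → fromℕ (numChains (suc m) k) ≡ powSuc k (m ⊖ k) ℚ.* fromℕ (reducedCount k m)
numChains-ℚ m k = begin
  fromℕ N
    ≡⟨ ℚ.*-identityˡ (fromℕ N) ⟨
  1ℚ ℚ.* fromℕ N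
    ≡⟨ cong (ℚ._* fromℕ N) (trans (cong (powSuc k) (sym (ℤ.n⊖n≡0 k))) (powSuc-⊖ k k k)) ⟩
  (powℚ κ⁻¹ k ℚ.* powℚ κ k) ℚ.* fromℕ N
    ≡⟨ ℚ.*-assoc (powℚ κ⁻¹ k) (powℚ κ k) (fromℕ N) ⟩
  powℚ κ⁻¹ k ℚ.* (powℚ κ k ℚ.* fromℕ N)
    ≡⟨ cong (powℚ κ⁻¹ k ℚ.*_) (trans (κ^e*n k N) (trans (cong fromℕ (numChains-reducedCount m k)) (sym (κ^e*n m Q)))) ⟩
  powℚ κ⁻¹ k ℚ.* (powℚ κ m ℚ.* fromℕ Q)
    ≡⟨ ℚ.*-assoc (powℚ κ⁻¹ k) (powℚ κ m) (fromℕ Q) ⟨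
  (powℚ κ⁻¹ k ℚ.* powℚ κ m) ℚ.* fromℕ Q
    ≡⟨ cong (ℚ._* fromℕ Q) (powSuc-⊖ k m k) ⟨
  powSuc k (m ⊖ k) ℚ.* fromℕ Q ∎
  where
  open ≡-Reasoning
  N = numChains (suc m) k
  Q = reducedCount k m
  κ = fromℕ (suc k)
  κ⁻¹ = + 1 / suc k
  κ^e*n : ∀ e n → powℚ κ e ℚ.* fromℕ n ≡ fromℕ (suc k ^ e * n)
  κ^e*n e n = sym (trans (fromℕ-* (suc k ^ e) n) (cong (ℚ._* fromℕ n) (fromℕ-^ (suc k) e)))

proposition3p7 : (k : ℕ) → 1 ≤ k →
    Σ (Vec ℚ k) λ cs →
      (n : ℕ) → 2 ≤ n →
        fromℕ (numChains n k) ≡ powSuc k (+ n - + suc k) Data.Rational.* monicEval cs (fromℕ n)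
proposition3p7 k _ = coeffs k (reducedPoly k) , λ { (suc m) _ → proof m }
  where
  open ≡-Reasoning
  proof : ∀ m → fromℕ (numChains (suc m) k)
                ≡ powSuc k (+ suc m - + suc k) ℚ.* monicEval (coeffs k (reducedPoly k)) (fromℕ (suc m))
  proof m = begin
    fromℕ (numChains (suc m) k)
      ≡⟨ numChains-ℚ m k ⟩
    powSuc k (m ⊖ k) ℚ.* fromℕ (reducedCount k m)
      ≡⟨ cong₂ ℚ._*_ (cong (powSuc k) (trans (ℤ.m-n≡m⊖n (suc m) (suc k)) (ℤ.[1+m]⊖[1+n]≡m⊖n m k)))
                     (trans (monicEval-coeffs k (reducedPoly k) _ (reducedPoly-top k)) (eval-reducedPoly k m)) ⟨
    powSuc k (+ suc m - + suc k) ℚ.* monicEval (coeffs k (reducedPoly k)) (fromℕ (suc m)) ∎
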